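{- Let $k\geq 2$ and $n\geq (2k)^{8k^2}$ be integers, and let $\alpha,\beta$ be real numbers with $\frac{2k+1}{8k+6}<\alpha\leq \frac{1}{4}$ and $\frac{1}{2}-2\alpha\leq \beta\leq \frac{\alpha}{2k+1}$. If $G$ is a $C_{2k+1}$-free graph on $n$ vertices with $\alpha n^2$ edges and minimum degree $\delta(G)\geq \left(\frac{1}{2}-\beta\right)n$, then $G$ is bipartite.
   Context: $C_{2k+1}$ denotes the cycle of length $2k+1$; a graph is $C_{2k+1}$-free if it has no subgraph isomorphic to $C_{2k+1}$. $\delta(G)$ is the minimum degree of $G$. Graphs are finite and simple.
   Formalization: The parameters α and β range over the rationals instead of the real numbers. -}

module Defs where

open import Data.Nat using (ℕ; zero; suc; _+_; _<ᵇ_)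
open import Data.Bool using (Bool; true; false; if_then_else_; _∧_)
open import Data.Fin using (Fin; zero; suc; toℕ; inject₁; fromℕ)
open import Data.Product using (Σ; _×_)
open import Data.Empty using (⊥)
open import Relation.Binary.PropositionalEquality using (_≡_; _≢_)
open import Function.Definitions using (Injective)
open import Data.Integer using (+_)
open import Data.Rational using (ℚ; _/_)

record Graph (n : ℕ) : Set where
  field
    adj   : Fin n → Fin n → Bool
    sym   : ∀ u v → adj u v ≡ adj v u
    irrefl : ∀ v → adj v v ≡ false
open Graph public

count : ∀ {n} → (Fin n → Bool) → ℕ
count {zero}  p = 0
count {suc n} p = (if p zero then 1 else 0) + count (λ i → p (suc i))

degree : ∀ {n} → Graph n → Fin n → ℕ
degree G v = count (adj G v)

edges : ∀ {n} → Graph n → ℕ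
edges {n} G = go (λ u → count (λ v → adj G u v ∧ (toℕ u <ᵇ toℕ v)))
  where
  go : ∀ {m} → (Fin m → ℕ) → ℕ
  go {zero} f = 0
  go {suc m} f = f zero + go (λ i → f (suc i))

HasCycle : ∀ {n} → Graph n → ℕ → Set
HasCycle {n} G zero = ⊥
HasCycle {n} G (suc m) =
  Σ (Fin (suc m) → Fin n) λ f →
    Injective _≡_ _≡_ f
    × (∀ (i : Fin m) → adj G (f (inject₁ i)) (f (suc i)) ≡ true)
    × (adj G (f (fromℕ m)) (f zero) ≡ true)

Bipartite : ∀ {n} → Graph n → Set
Bipartite {n} G = Σ (Fin n → Bool) λ c → ∀ u v → adj G u v ≡ true → c u ≢ c v

ℕ→ℚ : ℕ → ℚ
ℕ→ℚ m = + m / 1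

-- Since β ≤ α/(2k+1) ≤ 1/20, the minimum degree δ exceeds 9n/20 > 2n/5.  Call a pair
-- x, y heavy when 3·|N(x) ∩ N(y)| ≥ 3δ − n.  As d(x) + d(y) + d(z) is at most n plus
-- the three pairwise codegrees, among any three vertices some pair is heavy; as five
-- degrees sum to more than 2n, every closed 5-walk has an edge in a triangle, hence a
-- heavy edge.  For n large a heavy edge ab has more than 2(2k+1) common neighbours W.
-- If every x ∈ W has 2k+1 heavy partners in W put S = W; otherwise some x ∈ W has few,
-- and the vertices S of W not heavy to x are pairwise heavy.  A path from a alternating
-- between vertices of S and fresh common neighbours of consecutive (heavy) ones then
-- reaches length 2k, and b closes it to a C_{2k+1}.  Finally, colour u by whether it
-- has a common neighbour with a fixed v₀: a monochromatic edge uv either lies on a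
-- closed 5-walk through v₀, or has codegree zero with v₀ at both ends, which makes uv
-- itself heavy.
{-# OPTIONS --safe #-}
module Submission where

open import Defs hiding (sym)
open import Data.Nat as ℕ using (ℕ)
open import Data.Integer using (+_)
open import Data.Rational as ℚ using (ℚ; _/_)
open import Relation.Nullary using (¬_)
open import Relation.Binary.PropositionalEquality using (_≡_)

open import Data.Bool using (Bool; true; false; _∧_; not; if_then_else_; T)
import Data.Bool.Properties as Bool
open import Data.Fin using (Fin; zero; suc; inject₁; fromℕ; fromℕ<)
open import Data.Fin.Properties using (_≟_; any?)
import Data.Integer.Properties as ℤ
import Data.Integer as ℤ
open import Data.List using (List; []; _∷_; [_]; map; allFin)
import Data.List.Relation.Unary.All as List
open import Data.List.Membership.Propositional.Properties using (∈-allFin)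
open import Data.List.Extrema.Nat using (argmin; f[argmin]≤f[xs])
open import Data.Nat
  using (zero; suc; _+_; _*_; _^_; _≤_; _<_; z≤n; s≤s; z<s; s≤s⁻¹; _≤ᵇ_; _≤?_; _<?_; >-nonZero)
open import Data.Nat.Properties
  using ( +-mono-≤; +-mono-<-≤; +-monoˡ-≤; +-monoʳ-≤; +-cancelˡ-<; +-suc; +-identityʳ
        ; +-comm; *-distribˡ-+; *-suc; *-monoʳ-≤; *-monoʳ-<; *-monoˡ-<; *-cancelˡ-<; *-assoc; *-comm; *-identityʳ
        ; ^-monoʳ-≤; m≤m+n; m<m+n; m≤m*n; n<1+n; n≮n; n≮0; ≤ᵇ⇒≤; ≰⇒>; ≮⇒≥; <⇒≤
        ; ≤-refl; ≤-reflexive; ≤-trans; <-trans; <-≤-trans; ≤-<-trans; module ≤-Reasoning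
        ; +-commutativeSemigroup)
open import Algebra.Properties.CommutativeSemigroup +-commutativeSemigroup using (interchange)
open import Data.Nat.Tactic.RingSolver using (solve-∀)
open import Data.Product using (∃-syntax; _×_; _,_; proj₁; proj₂)
import Data.Rational.Properties as ℚ
open import Data.Rational.Unnormalised as ℚᵘ using (mkℚᵘ; *≤*; _≃_)
import Data.Rational.Unnormalised.Properties as ℚᵘ
open import Data.Sum using (_⊎_; inj₁; inj₂)
open import Data.Vec using (Vec; []; _∷_; lookup; head)
open import Data.Vec.N-ary as N-ary using (N-ary)
open import Data.Vec.Relation.Unary.All using (All; []; _∷_)
import Data.Vec.Relation.Unary.All as All
open import Data.Vec.Relation.Unary.Linked using (Linked; [-]; _∷_)
open import Data.Vec.Relation.Unary.Unique.Propositional using (Unique; []; _∷_)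
import Data.Vec.Relation.Unary.Unique.Propositional as Unique
open import Data.Vec.Relation.Unary.Unique.Propositional.Properties using (lookup-injective)
open import Function using (_∘_; id; Equivalence)
open import Relation.Nullary using (Dec; yes; no; does; contradiction)
open import Relation.Nullary.Decidable using (_×-dec_)
open import Relation.Binary.PropositionalEquality
  using (_≢_; refl; sym; trans; cong; cong₂; subst; subst₂; ≢-sym; module ≡-Reasoning)

indicator : Bool → ℕ
indicator b = if b then 1 else 0

tally : ∀ {n} → List (Fin n → Bool) → Fin n → ℕ
tally []       i = 0
tally (p ∷ ps) i = indicator (p i) + tally ps i

counts : ∀ {n} → List (Fin n → Bool) → ℕ
counts []       = 0
counts (p ∷ ps) = count p + counts ps

private
  shift : ∀ {n} → List (Fin (suc n) → Bool) → List (Fin n → Bool)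
  shift = map (_∘ suc)

  tally-shift : ∀ {n} (ps : List (Fin (suc n) → Bool)) i → tally (shift ps) i ≡ tally ps (suc i)
  tally-shift []       i = refl
  tally-shift (p ∷ ps) i = cong (indicator (p (suc i)) ℕ.+_) (tally-shift ps i)

  counts-suc : ∀ {n} (ps : List (Fin (suc n) → Bool)) → counts ps ≡ tally ps zero + counts (shift ps)
  counts-suc []       = refl
  counts-suc (p ∷ ps) = begin
    (indicator (p zero) + count (p ∘ suc)) + counts ps
      ≡⟨ cong (_ ℕ.+_) (counts-suc ps) ⟩
    (indicator (p zero) + count (p ∘ suc)) + (tally ps zero + counts (shift ps))
      ≡⟨ interchange (indicator (p zero)) (count (p ∘ suc)) (tally ps zero) (counts (shift ps)) ⟩
    (indicator (p zero) + tally ps zero) + (count (p ∘ suc) + counts (shift ps)) ∎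
    where open ≡-Reasoning

counts-≤ : ∀ {n} c (ps qs : List (Fin n → Bool)) →
  (∀ i → tally ps i ≤ c + tally qs i) → counts ps ≤ c * n + counts qs
counts-≤ {zero}  c []       qs _ = z≤n
counts-≤ {zero}  c (p ∷ ps) qs _ = counts-≤ c ps qs (λ ())
counts-≤ {suc n} c ps qs h = begin
  counts ps                                         ≡⟨ counts-suc ps ⟩
  tally ps zero + counts (shift ps)                 ≤⟨ +-mono-≤ (h zero) (counts-≤ c (shift ps) (shift qs) h′) ⟩
  (c + tally qs zero) + (c * n + counts (shift qs)) ≡⟨ interchange c _ _ _ ⟩
  (c + c * n) + (tally qs zero + counts (shift qs)) ≡⟨ cong₂ _+_ (sym (*-suc c n)) (sym (counts-suc qs)) ⟩
  c * suc n + counts qs                             ∎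
  where
  open ≤-Reasoning
  h′ : ∀ i → tally (shift ps) i ≤ c + tally (shift qs) i
  h′ i = subst₂ (λ s t → s ≤ c + t) (sym (tally-shift ps i)) (sym (tally-shift qs i)) (h (suc i))

all-≤ᵇ : ∀ m → N-ary m Bool ℕ → N-ary m Bool ℕ → Bool
all-≤ᵇ zero    l r = l ≤ᵇ r
all-≤ᵇ (suc m) l r = all-≤ᵇ m (l true) (r true) ∧ all-≤ᵇ m (l false) (r false)

by-evaluation : ∀ m (l r : N-ary m Bool ℕ) → T (all-≤ᵇ m l r) → N-ary.Eq m _≤_ l r
by-evaluation zero    l r t       = ≤ᵇ⇒≤ l r t
by-evaluation (suc m) l r t true  = by-evaluation m (l true) (r true) (proj₁ (Equivalence.to Bool.T-∧ t))
by-evaluation (suc m) l r t false = by-evaluation m (l false) (r false) (proj₂ (Equivalence.to Bool.T-∧ t))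

-- Stated in the shape tally takes on explicit lists, hence the trailing + 0.
inclusion-exclusion³ : ∀ x y z →
  indicator x + (indicator y + (indicator z + 0)) ≤
  1 + (indicator (x ∧ y) + (indicator (x ∧ z) + (indicator (y ∧ z) + 0)))
inclusion-exclusion³ = by-evaluation 3 _ _ _

inclusion-exclusion⁵ : ∀ x₀ x₁ x₂ x₃ x₄ →
  indicator x₀ + (indicator x₁ + (indicator x₂ + (indicator x₃ + (indicator x₄ + 0)))) ≤
  2 + (indicator (x₀ ∧ x₁) + (indicator (x₁ ∧ x₂) + (indicator (x₂ ∧ x₃) +
      (indicator (x₃ ∧ x₄) + (indicator (x₄ ∧ x₀) + 0)))))
inclusion-exclusion⁵ = by-evaluation 5 _ _ _

indicator-≤-either : ∀ x y → indicator x ≤ indicator y + indicator (x ∧ not y)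
indicator-≤-either = by-evaluation 2 _ _ _

indicator-split : ∀ x y → indicator x ≤ indicator (x ∧ y) + indicator (x ∧ not y)
indicator-split = by-evaluation 2 _ _ _

count-split : ∀ {n} (p q r : Fin n → Bool) →
  (∀ i → indicator (p i) ≤ indicator (q i) + indicator (r i)) → count p ≤ count q + count r
count-split p q r h = subst₂ _≤_ (+-identityʳ (count p)) (cong (count q ℕ.+_) (+-identityʳ (count r)))
  (counts-≤ 0 [ p ] (q ∷ [ r ]) λ i →
    subst₂ _≤_ (sym (+-identityʳ _)) (cong (indicator (q i) ℕ.+_) (sym (+-identityʳ _))) (h i))

count-false : ∀ n → count {n} (λ _ → false) ≡ 0
count-false zero    = refl
count-false (suc n) = count-false n

count-≟ : ∀ {n} (x : Fin n) → count (λ z → does (z ≟ x)) ≡ 1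
count-≟ {suc n} zero    = cong suc (count-false n)
count-≟ {suc n} (suc x) = count-≟ x

0<count⇒∃ : ∀ {n} (p : Fin n → Bool) → 0 < count p → ∃[ i ] p i ≡ true
0<count⇒∃ {suc n} p h with p zero in p0
... | true  = zero , p0
... | false = let i , pi = 0<count⇒∃ (p ∘ suc) h in suc i , pi

does≡true⇒ : ∀ {A : Set} (a? : Dec A) → does a? ≡ true → A
does≡true⇒ (yes a) _ = a

not-does≡true⇒¬ : ∀ {A : Set} (a? : Dec A) → not (does a?) ≡ true → ¬ A
not-does≡true⇒¬ (no ¬a) _ = ¬a

count>length⇒fresh : ∀ {n m} (p : Fin n → Bool) (L : Vec (Fin n) m) → m < count p →
  ∃[ z ] p z ≡ true × All (z ≢_) L
count>length⇒fresh p []      h = let z , pz = 0<count⇒∃ p h in z , pz , []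
count>length⇒fresh {m = suc m} p (x ∷ L) h with count>length⇒fresh p′ L (s≤s⁻¹ (≤-trans h split))
  where
  p′ = λ z → p z ∧ not (does (z ≟ x))
  split : count p ≤ 1 + count p′
  split = subst (λ c → count p ≤ c + count p′) (count-≟ x)
    (count-split p _ p′ λ z → indicator-≤-either (p z) (does (z ≟ x)))
... | z , p′z , z∉L =
  z , Bool.∧-conicalˡ _ _ p′z , not-does≡true⇒¬ (z ≟ x) (Bool.∧-conicalʳ _ _ p′z) ∷ z∉L

linked-lookup : ∀ {A : Set} {R : A → A → Set} {m} {xs : Vec A (suc m)} →
  Linked R xs → ∀ i → R (lookup xs (inject₁ i)) (lookup xs (suc i))
linked-lookup {xs = _ ∷ _ ∷ _} (r ∷ _) zero = r
linked-lookup (_ ∷ rs) (suc i) = linked-lookup rs i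

module MinDegree {n} (G : Graph n) (δ : ℕ) (δ≤degree : ∀ v → δ ≤ degree G v) (2n<5δ : 2 * n < 5 * δ) where

  _~_ : Fin n → Fin n → Set
  x ~ y = adj G x y ≡ true

  ~-sym : ∀ {x y} → x ~ y → y ~ x
  ~-sym {x} {y} = trans (Graph.sym G y x)

  ~⇒≢ : ∀ {x y} → x ~ y → x ≢ y
  ~⇒≢ {x} x~x refl = contradiction (trans (sym x~x) (irrefl G x)) λ ()

  common : Fin n → Fin n → Fin n → Bool
  common x y z = adj G x z ∧ adj G y z

  codegree : Fin n → Fin n → ℕ
  codegree x y = count (common x y)

  common⇒~ : ∀ {x y z} → common x y z ≡ true → x ~ z × y ~ z
  common⇒~ e = Bool.∧-conicalˡ _ _ e , Bool.∧-conicalʳ _ _ e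

  Heavy : Fin n → Fin n → Set
  Heavy x y = 3 * δ ≤ n + 3 * codegree x y

  heavy? : ∀ x y → Dec (Heavy x y)
  heavy? x y = 3 * δ ≤? n + 3 * codegree x y

  degree-sum³ : ∀ x y z →
    degree G x + (degree G y + (degree G z + 0)) ≤
    1 * n + (codegree x y + (codegree x z + (codegree y z + 0)))
  degree-sum³ x y z = counts-≤ 1 (adj G x ∷ adj G y ∷ [ adj G z ]) (common x y ∷ common x z ∷ [ common y z ])
    λ i → inclusion-exclusion³ (adj G x i) (adj G y i) (adj G z i)

  degree-sum⁵ : ∀ x₀ x₁ x₂ x₃ x₄ →
    degree G x₀ + (degree G x₁ + (degree G x₂ + (degree G x₃ + (degree G x₄ + 0)))) ≤
    2 * n + (codegree x₀ x₁ + (codegree x₁ x₂ + (codegree x₂ x₃ + (codegree x₃ x₄ + (codegree x₄ x₀ + 0)))))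
  degree-sum⁵ x₀ x₁ x₂ x₃ x₄ =
    counts-≤ 2 (adj G x₀ ∷ adj G x₁ ∷ adj G x₂ ∷ adj G x₃ ∷ [ adj G x₄ ])
               (common x₀ x₁ ∷ common x₁ x₂ ∷ common x₂ x₃ ∷ common x₃ x₄ ∷ [ common x₄ x₀ ])
    λ i → inclusion-exclusion⁵ (adj G x₀ i) (adj G x₁ i) (adj G x₂ i) (adj G x₃ i) (adj G x₄ i)

  heavy⇒codegree : ∀ {x y} → Heavy x y → n < 15 * codegree x y
  heavy⇒codegree {x} {y} h = +-cancelˡ-< (5 * n) n (15 * c) (begin-strict
    5 * n + n           ≡⟨ trans (+-comm (5 * n) n) (*-assoc 3 2 n) ⟩
    3 * (2 * n)         <⟨ *-monoʳ-< 3 2n<5δ ⟩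
    3 * (5 * δ)         ≡⟨ trans (sym (*-assoc 3 5 δ)) (*-assoc 5 3 δ) ⟩
    5 * (3 * δ)         ≤⟨ *-monoʳ-≤ 5 h ⟩
    5 * (n + 3 * c)     ≡⟨ *-distribˡ-+ 5 n (3 * c) ⟩
    5 * n + 5 * (3 * c) ≡⟨ cong (5 * n ℕ.+_) (sym (*-assoc 5 3 c)) ⟩
    5 * n + 15 * c      ∎)
    where
    open ≤-Reasoning
    c = codegree x y

  codegree≤0⇒light : ∀ {x y} → codegree x y ≤ 0 → ¬ Heavy x y
  codegree≤0⇒light c≤0 h = n≮0 (<-≤-trans (heavy⇒codegree h) (*-monoʳ-≤ 15 c≤0))

  heavy-pair : ∀ x y z → Heavy x y ⊎ Heavy x z ⊎ Heavy y z
  heavy-pair x y z with heavy? x y | heavy? x z | heavy? y z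
  ... | yes h  | _      | _      = inj₁ h
  ... | no _   | yes h  | _      = inj₂ (inj₁ h)
  ... | no _   | no _   | yes h  = inj₂ (inj₂ h)
  ... | no ¬xy | no ¬xz | no ¬yz = contradiction (begin-strict
    3 * (1 * n + (cxy + (cxz + (cyz + 0))))
      ≡⟨ rearrange n cxy cxz cyz ⟩
    (n + 3 * cxy) + ((n + 3 * cxz) + ((n + 3 * cyz) + 0))
      <⟨ +-mono-<-≤ (≰⇒> ¬xy) (+-mono-≤ (<⇒≤ (≰⇒> ¬xz)) (+-mono-≤ (<⇒≤ (≰⇒> ¬yz)) z≤n)) ⟩
    3 * δ + (3 * δ + (3 * δ + 0))
      ≡⟨ rearrange′ δ ⟩
    3 * (δ + (δ + (δ + 0)))
      ≤⟨ *-monoʳ-≤ 3 (+-mono-≤ (δ≤degree x) (+-mono-≤ (δ≤degree y) (+-mono-≤ (δ≤degree z) z≤n))) ⟩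
    3 * (degree G x + (degree G y + (degree G z + 0)))
      ≤⟨ *-monoʳ-≤ 3 (degree-sum³ x y z) ⟩
    3 * (1 * n + (cxy + (cxz + (cyz + 0)))) ∎) (n≮n _)
    where
    open ≤-Reasoning
    cxy = codegree x y
    cxz = codegree x z
    cyz = codegree y z
    rearrange : ∀ n a b c → 3 * (1 * n + (a + (b + (c + 0)))) ≡ (n + 3 * a) + ((n + 3 * b) + ((n + 3 * c) + 0))
    rearrange = solve-∀
    rearrange′ : ∀ d → 3 * d + (3 * d + (3 * d + 0)) ≡ 3 * (d + (d + (d + 0)))
    rearrange′ = solve-∀

  heavy-third : ∀ {x y z} → ¬ Heavy x y → ¬ Heavy x z → Heavy y z
  heavy-third {x} {y} {z} ¬xy ¬xz with heavy-pair x y z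
  ... | inj₁ xy        = contradiction xy ¬xy
  ... | inj₂ (inj₁ xz) = contradiction xz ¬xz
  ... | inj₂ (inj₂ yz) = yz

  record Triangle : Set where
    constructor triangle
    field
      {x y z} : Fin n
      x~y : x ~ y
      x~z : x ~ z
      y~z : y ~ z

  record HeavyEdge : Set where
    constructor heavy-edge
    field
      {x y} : Fin n
      x~y   : x ~ y
      heavy : Heavy x y

  triangle⇒heavy-edge : Triangle → HeavyEdge
  triangle⇒heavy-edge (triangle {x} {y} {z} x~y x~z y~z) with heavy-pair x y z
  ... | inj₁ xy        = heavy-edge x~y xy
  ... | inj₂ (inj₁ xz) = heavy-edge x~z xz
  ... | inj₂ (inj₂ yz) = heavy-edge y~z yz

  codegree>0⇒triangle : ∀ {x y} → x ~ y → 0 < codegree x y → Triangle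
  codegree>0⇒triangle {x} {y} x~y c>0 =
    let z , xyz = 0<count⇒∃ (common x y) c>0
    in  triangle x~y (proj₁ (common⇒~ xyz)) (proj₂ (common⇒~ xyz))

  closed-walk⁵⇒triangle : ∀ {x₀ x₁ x₂ x₃ x₄} →
    x₀ ~ x₁ → x₁ ~ x₂ → x₂ ~ x₃ → x₃ ~ x₄ → x₄ ~ x₀ → Triangle
  closed-walk⁵⇒triangle {x₀} {x₁} {x₂} {x₃} {x₄} e₀₁ e₁₂ e₂₃ e₃₄ e₄₀
    with 0 <? codegree x₀ x₁ | 0 <? codegree x₁ x₂ | 0 <? codegree x₂ x₃
       | 0 <? codegree x₃ x₄ | 0 <? codegree x₄ x₀
  ... | yes c | _     | _     | _     | _     = codegree>0⇒triangle e₀₁ c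
  ... | no _  | yes c | _     | _     | _     = codegree>0⇒triangle e₁₂ c
  ... | no _  | no _  | yes c | _     | _     = codegree>0⇒triangle e₂₃ c
  ... | no _  | no _  | no _  | yes c | _     = codegree>0⇒triangle e₃₄ c
  ... | no _  | no _  | no _  | no _  | yes c = codegree>0⇒triangle e₄₀ c
  ... | no c₀ | no c₁ | no c₂ | no c₃ | no c₄ = contradiction (begin-strict
    5 * δ
      ≤⟨ +-mono-≤ (δ≤degree x₀) (+-mono-≤ (δ≤degree x₁) (+-mono-≤ (δ≤degree x₂)
           (+-mono-≤ (δ≤degree x₃) (+-mono-≤ (δ≤degree x₄) z≤n)))) ⟩
    degree G x₀ + (degree G x₁ + (degree G x₂ + (degree G x₃ + (degree G x₄ + 0))))
      ≤⟨ degree-sum⁵ x₀ x₁ x₂ x₃ x₄ ⟩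
    2 * n + (codegree x₀ x₁ + (codegree x₁ x₂ + (codegree x₂ x₃ + (codegree x₃ x₄ + (codegree x₄ x₀ + 0)))))
      ≤⟨ +-monoʳ-≤ (2 * n) (+-mono-≤ (≮⇒≥ c₀) (+-mono-≤ (≮⇒≥ c₁) (+-mono-≤ (≮⇒≥ c₂)
           (+-mono-≤ (≮⇒≥ c₃) (+-mono-≤ (≮⇒≥ c₄) z≤n))))) ⟩
    2 * n + 0
      ≡⟨ +-identityʳ (2 * n) ⟩
    2 * n
      <⟨ 2n<5δ ⟩
    5 * δ ∎) (n≮n _)
    where open ≤-Reasoning

  common-neighbour-colour : Fin n → Fin n → Bool
  common-neighbour-colour v₀ u = does (0 <? codegree v₀ u)

  monochromatic-edge⇒heavy-edge : ∀ v₀ {u v} → u ~ v →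
    common-neighbour-colour v₀ u ≡ common-neighbour-colour v₀ v → HeavyEdge
  monochromatic-edge⇒heavy-edge v₀ {u} {v} u~v = by-cases (0 <? codegree v₀ u) (0 <? codegree v₀ v)
    where
    by-cases : (cu? : Dec (0 < codegree v₀ u)) (cv? : Dec (0 < codegree v₀ v)) → does cu? ≡ does cv? → HeavyEdge
    by-cases (yes cu) (yes cv) _ =
      let w  , v₀uw  = 0<count⇒∃ (common v₀ u) cu
          w′ , v₀vw′ = 0<count⇒∃ (common v₀ v) cv
      in  triangle⇒heavy-edge (closed-walk⁵⇒triangle (proj₁ (common⇒~ v₀uw)) (~-sym (proj₂ (common⇒~ v₀uw)))
            u~v (proj₂ (common⇒~ v₀vw′)) (~-sym (proj₁ (common⇒~ v₀vw′))))
    by-cases (no cu) (no cv) _ =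
      heavy-edge u~v (heavy-third (codegree≤0⇒light (≮⇒≥ cu)) (codegree≤0⇒light (≮⇒≥ cv)))

  module OddCycle (j : ℕ) (large : 30 * (3 + (j + j)) ≤ n) where

    ℓ : ℕ
    ℓ = 3 + (j + j)

    heavy⇒wide : ∀ {x y} → Heavy x y → ℓ + ℓ < codegree x y
    heavy⇒wide h = *-cancelˡ-< 15 _ _ (≤-<-trans (≤-reflexive (thirty ℓ)) (≤-<-trans large (heavy⇒codegree h)))
      where
      thirty : ∀ l → 15 * (l + l) ≡ 30 * l
      thirty = solve-∀

    Expanding : (Fin n → Bool) → Set
    Expanding S = ∀ {m} x (L : Vec (Fin n) m) → S x ≡ true → m < ℓ →
      ∃[ z ] S z ≡ true × Heavy x z × All (z ≢_) L

    module Ladder {a b} (a~b : a ~ b) (S : Fin n → Bool)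
                  (S⊆common : ∀ {z} → S z ≡ true → common a b z ≡ true) (expanding : Expanding S) where

      record Path (m : ℕ) : Set where
        field
          vertices    : Vec (Fin n) (suc m)
          starts-in-S : S (head vertices) ≡ true
          linked      : Linked _~_ vertices
          distinct    : Unique (b ∷ vertices)
          ends-at-a   : lookup vertices (fromℕ m) ≡ a
      open Path

      start : ∀ {s} → S s ≡ true → Path 1
      start {s} s∈S = record
        { vertices    = s ∷ a ∷ []
        ; starts-in-S = s∈S
        ; linked      = ~-sym a~s ∷ [-]
        ; distinct    = (~⇒≢ b~s ∷ ≢-sym (~⇒≢ a~b) ∷ []) ∷ (≢-sym (~⇒≢ a~s) ∷ []) ∷ [] ∷ []
        ; ends-at-a   = refl
        }
        where
        a~s = proj₁ (common⇒~ (S⊆common s∈S))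
        b~s = proj₂ (common⇒~ (S⊆common s∈S))

      -- w ∈ S is a heavy partner of the head x, and y a fresh common neighbour of x and w.
      extend : ∀ {m} → Path m → 3 + m < ℓ → Path (2 + m)
      extend {m} p bound = record
        { vertices    = w ∷ y ∷ vertices p
        ; starts-in-S = w∈S
        ; linked      = proj₂ (common⇒~ xwy) ∷ ~-sym (proj₁ (common⇒~ xwy)) ∷ linked p
        ; distinct    = (≢-sym (All.head w∉) ∷ ≢-sym (All.head (All.tail y∉)) ∷ Unique.head (distinct p))
                      ∷ (≢-sym (All.head y∉) ∷ All.tail w∉)
                      ∷ All.tail (All.tail y∉) ∷ Unique.tail (distinct p)
        ; ends-at-a   = ends-at-a p
        }
        where
        x = head (vertices p)
        next = expanding x (b ∷ vertices p) (starts-in-S p) (<-trans (n<1+n _) bound)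
        w    = proj₁ next
        w∈S  = proj₁ (proj₂ next)
        w∉   = proj₂ (proj₂ (proj₂ next))
        wide = ≤-<-trans (m≤m+n ℓ ℓ) (heavy⇒wide (proj₁ (proj₂ (proj₂ next))))
        link = count>length⇒fresh (common x w) (w ∷ b ∷ vertices p) (<-trans bound wide)
        y    = proj₁ link
        xwy  = proj₁ (proj₂ link)
        y∉   = proj₂ (proj₂ link)

      path : ∀ {s₀} → S s₀ ≡ true → ∀ s → s ≤ j → Path (1 + (s + s))
      path s₀∈S zero    _   = start s₀∈S
      path s₀∈S (suc s) s<j = subst Path (cong (λ t → 2 + t) (sym (+-suc s s)))
        (extend (path s₀∈S s (<⇒≤ s<j))
          (s≤s (s≤s (s≤s (subst (_≤ j + j) (cong suc (+-suc s s)) (+-mono-≤ s<j s<j))))))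

      close : Path (1 + (j + j)) → HasCycle G ℓ
      close p = lookup (b ∷ vertices p)
              , (λ {i} {k} → lookup-injective (distinct p) i k)
              , linked-lookup (b~x ∷ linked p)
              , subst (_~ b) (sym (ends-at-a p)) a~b
        where b~x = proj₂ (common⇒~ (S⊆common (starts-in-S p)))

      cycle : 0 < count S → HasCycle G ℓ
      cycle S≢∅ = close (path (proj₂ (0<count⇒∃ S S≢∅)) j ≤-refl)

    module HeavyEdgeCycle {a b} (a~b : a ~ b) (heavy-ab : Heavy a b) where

      W : Fin n → Bool
      W = common a b

      heavy-partners light-partners : Fin n → Fin n → Bool
      heavy-partners x z = W z ∧ does (heavy? x z)
      light-partners x z = W z ∧ not (does (heavy? x z))

      rich⇒expanding : (∀ x → W x ≡ true → ℓ ≤ count (heavy-partners x)) → Expanding W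
      rich⇒expanding rich x L x∈W m<ℓ =
        let z , xz , z∉L = count>length⇒fresh (heavy-partners x) L (<-≤-trans m<ℓ (rich x x∈W))
        in  z , Bool.∧-conicalˡ _ _ xz , does≡true⇒ (heavy? x z) (Bool.∧-conicalʳ _ _ xz) , z∉L

      poor⇒many-light : ∀ {x} → count (heavy-partners x) < ℓ → ℓ < count (light-partners x)
      poor⇒many-light {x} poor = +-cancelˡ-< ℓ ℓ (count (light-partners x)) (begin-strict
        ℓ + ℓ                                              <⟨ heavy⇒wide heavy-ab ⟩
        count W                                            ≤⟨ count-split W _ _ (λ z → indicator-split (W z) _) ⟩
        count (heavy-partners x) + count (light-partners x) ≤⟨ +-monoˡ-≤ _ (<⇒≤ poor) ⟩
        ℓ + count (light-partners x)                       ∎)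
        where open ≤-Reasoning

      light-partner⇒light : ∀ {x z} → light-partners x z ≡ true → ¬ Heavy x z
      light-partner⇒light {x} {z} xz = not-does≡true⇒¬ (heavy? x z) (Bool.∧-conicalʳ _ _ xz)

      -- Any two light partners of x are heavy to each other.
      poor⇒expanding : ∀ {x} → count (heavy-partners x) < ℓ → Expanding (light-partners x)
      poor⇒expanding {x} poor y L xy m<ℓ =
        let z , xz , z∉L = count>length⇒fresh (light-partners x) L (<-trans m<ℓ (poor⇒many-light poor))
        in  z , xz , heavy-third (light-partner⇒light xy) (light-partner⇒light xz) , z∉L

      cycle : HasCycle G ℓ
      cycle with any? (λ x → (W x Bool.≟ true) ×-dec (count (heavy-partners x) <? ℓ))
      ... | yes (x , x∈W , poor) =
        Ladder.cycle a~b (light-partners x) (Bool.∧-conicalˡ _ _) (poor⇒expanding poor)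
          (≤-<-trans z≤n (poor⇒many-light poor))
      ... | no ¬poor =
        Ladder.cycle a~b W id (rich⇒expanding λ x x∈W → ≮⇒≥ λ poor → ¬poor (x , x∈W , poor))
          (≤-<-trans z≤n (heavy⇒wide heavy-ab))

    heavy-edge⇒cycle : HeavyEdge → HasCycle G ℓ
    heavy-edge⇒cycle (heavy-edge a~b heavy-ab) = HeavyEdgeCycle.cycle a~b heavy-ab

  bipartite : ∀ j → 30 * (3 + (j + j)) ≤ n → ¬ HasCycle G (3 + (j + j)) → Fin n → Bipartite G
  bipartite j large no-cycle v₀ = common-neighbour-colour v₀ , λ u v u~v same →
    no-cycle (OddCycle.heavy-edge⇒cycle j large (monochromatic-edge⇒heavy-edge v₀ u~v same))

toℚᵘ-/ : ∀ a b → ℚ.toℚᵘ (+ a / suc b) ≃ mkℚᵘ (+ a) b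
toℚᵘ-/ a b = ℚ.toℚᵘ-fromℚᵘ (mkℚᵘ (+ a) b)

/-mono-≤ : ∀ {a b c d} → a ℕ.* suc d ≤ c ℕ.* suc b → (+ a / suc b) ℚ.≤ (+ c / suc d)
/-mono-≤ {a} {b} {c} {d} h = ℚ.toℚᵘ-cancel-≤
  (ℚᵘ.≤-respʳ-≃ (ℚᵘ.≃-sym (toℚᵘ-/ c d)) (ℚᵘ.≤-respˡ-≃ (ℚᵘ.≃-sym (toℚᵘ-/ a b))
    (*≤* (subst₂ ℤ._≤_ (ℤ.pos-* a (suc d)) (ℤ.pos-* c (suc b)) (ℤ.+≤+ h)))))

/-*-≤-cancel : ∀ a b m d → (+ a / suc b) ℚ.* ℕ→ℚ m ℚ.≤ ℕ→ℚ d → a ℕ.* m ≤ suc b ℕ.* d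
/-*-≤-cancel a b m d h with ℚᵘ.≤-respʳ-≃ (toℚᵘ-/ d 0)
  (ℚᵘ.≤-respˡ-≃ (ℚᵘ.≃-trans (ℚ.toℚᵘ-homo-* (+ a / suc b) (ℕ→ℚ m))
                            (ℚᵘ.*-cong (toℚᵘ-/ a b) (toℚᵘ-/ m 0)))
    (ℚ.toℚᵘ-mono-≤ h))
... | *≤* am≤db = ℤ.drop‿+≤+ (subst₂ ℤ._≤_ (trans (ℤ.*-identityʳ _) (ℤ.+◃n≡+n (a ℕ.* m))) (begin
  + d ℤ.* + suc (b ℕ.* 1) ≡⟨ ℤ.pos-* d (suc (b ℕ.* 1)) ⟨
  + (d ℕ.* suc (b ℕ.* 1)) ≡⟨ cong (λ c → + (d ℕ.* suc c)) (*-identityʳ b) ⟩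
  + (d ℕ.* suc b)         ≡⟨ cong +_ (*-comm d (suc b)) ⟩
  + (suc b ℕ.* d)         ∎) am≤db)
  where open ≡-Reasoning

β≤1/20 : ∀ k (α β : ℚ) → 2 ≤ k → α ℚ.≤ (+ 1 / 4) → β ℚ.≤ α ℚ.* (+ 1 / suc (2 ℕ.* k)) →
  β ℚ.≤ (+ 1 / 20)
β≤1/20 k α β k≥2 α≤1/4 β≤α/[2k+1] = ℚ.≤-trans β≤α/[2k+1]
  (ℚ.≤-trans (ℚ.*-monoʳ-≤-nonNeg r α≤1/4) (ℚ.*-monoˡ-≤-nonNeg (+ 1 / 4) r≤1/5))
  where
  r = + 1 / suc (2 ℕ.* k)
  instance
    r≥0 : ℚ.NonNegative r
    r≥0 = ℚ.normalize-nonNeg 1 (suc (2 ℕ.* k))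
  r≤1/5 : r ℚ.≤ (+ 1 / 5)
  r≤1/5 = /-mono-≤ {1} {2 ℕ.* k} {1} {4} (*-monoʳ-≤ 1 (s≤s (*-monoʳ-≤ 2 k≥2)))

nine-twentieths-degree : ∀ k n d (α β : ℚ) → 2 ≤ k →
  α ℚ.≤ (+ 1 / 4) → β ℚ.≤ α ℚ.* (+ 1 / suc (2 ℕ.* k)) →
  ((+ 1 / 2) ℚ.- β) ℚ.* ℕ→ℚ n ℚ.≤ ℕ→ℚ d → 9 ℕ.* n ≤ 20 ℕ.* d
nine-twentieths-degree k n d α β k≥2 α≤1/4 β≤α/[2k+1] deg = /-*-≤-cancel 9 19 n d
  (ℚ.≤-trans (ℚ.*-monoʳ-≤-nonNeg (ℕ→ℚ n) 9/20≤1/2-β) deg)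
  where
  instance
    n≥0 : ℚ.NonNegative (ℕ→ℚ n)
    n≥0 = ℚ.normalize-nonNeg n 1
  9/20≤1/2-β : (+ 9 / 20) ℚ.≤ ((+ 1 / 2) ℚ.- β)
  9/20≤1/2-β = ℚ.+-monoʳ-≤ (+ 1 / 2) (ℚ.neg-antimono-≤ (β≤1/20 k α β k≥2 α≤1/4 β≤α/[2k+1]))

minimum-degree : ∀ {n} (G : Graph n) → Fin n → ∃[ v₀ ] ∀ v → degree G v₀ ≤ degree G v
minimum-degree {n} G v = argmin (degree G) v (allFin n)
                       , λ u → List.lookup (f[argmin]≤f[xs] v (allFin n)) (∈-allFin u)

nine-twentieths⇒two-fifths : ∀ {n d} → 0 < n → 9 * n ≤ 20 * d → 2 * n < 5 * d
nine-twentieths⇒two-fifths {n} {d} n>0 9n≤20d = *-cancelˡ-< 20 _ _ (begin-strict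
  20 * (2 * n)  ≡⟨ *-assoc 20 2 n ⟨
  40 * n        <⟨ *-monoˡ-< n {{>-nonZero n>0}} (m<m+n 40 {5} z<s) ⟩
  45 * n        ≡⟨ *-assoc 5 9 n ⟩
  5 * (9 * n)   ≤⟨ *-monoʳ-≤ 5 9n≤20d ⟩
  5 * (20 * d)  ≡⟨ trans (sym (*-assoc 5 20 d)) (*-assoc 20 5 d) ⟩
  20 * (5 * d)  ∎)
  where open ≤-Reasoning

thirty-odd≤power : ∀ k → 2 ≤ k → 30 * (2 * k + 1) ≤ (2 * k) ^ (8 * k * k)
thirty-odd≤power k@(suc (suc t)) (s≤s (s≤s z≤n)) = begin
  30 * (2 * k + 1)                         ≤⟨ m≤m+n _ _ ⟩
  30 * (2 * k + 1) + remainder             ≡⟨ expand t ⟩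
  (2 * k) ^ 4                              ≤⟨ ^-monoʳ-≤ (2 * k) 4≤8kk ⟩
  (2 * k) ^ (8 * k * k)                    ∎
  where
  open ≤-Reasoning
  4≤8kk = ≤-trans (m≤m*n 4 2) (≤-trans (m≤m*n 8 k) (m≤m*n (8 * k) k))
  remainder = 16 * (t * t * t * t) + 128 * (t * t * t) + 384 * (t * t) + 452 * t + 106
  expand : ∀ t → 30 * (2 * (2 + t) + 1) + (16 * (t * t * t * t) + 128 * (t * t * t) + 384 * (t * t) + 452 * t + 106)
               ≡ 2 * (2 + t) * (2 * (2 + t) * (2 * (2 + t) * (2 * (2 + t) * 1)))
  expand = solve-∀

odd-length : ∀ j → 2 * suc j + 1 ≡ 3 + (j + j)
odd-length = solve-∀

lemma2p3 : (k n : ℕ) → 2 ℕ.≤ k → (2 ℕ.* k) ℕ.^ (8 ℕ.* k ℕ.* k) ℕ.≤ n →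
    (α β : ℚ) →
    (+ (2 ℕ.* k ℕ.+ 1) / (ℕ.suc (8 ℕ.* k ℕ.+ 5))) ℚ.< α → α ℚ.≤ (+ 1 / 4) →
    ((+ 1 / 2) ℚ.- (+ 2 / 1) ℚ.* α) ℚ.≤ β → β ℚ.≤ α ℚ.* (+ 1 / ℕ.suc (2 ℕ.* k)) →
    (G : Graph n) → ¬ HasCycle G (2 ℕ.* k ℕ.+ 1) →
    ℕ→ℚ (edges G) ≡ α ℚ.* ℕ→ℚ (n ℕ.* n) →
    (∀ v → ((+ 1 / 2) ℚ.- β) ℚ.* ℕ→ℚ n ℚ.≤ ℕ→ℚ (degree G v)) →
    Bipartite G
lemma2p3 k@(suc j) n k≥2 n≥power α β _ α≤1/4 _ β≤α/[2k+1] G C₂ₖ₊₁-free _ degree≥ =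
  MinDegree.bipartite G δ δ≤degree 2n<5δ j large (C₂ₖ₊₁-free ∘ subst (HasCycle G) (sym (odd-length j))) v₀
  where
  large : 30 * (3 + (j + j)) ≤ n
  large = subst (λ l → 30 * l ≤ n) (odd-length j) (≤-trans (thirty-odd≤power k k≥2) n≥power)
  v₀ : Fin n
  v₀ = fromℕ< (<-≤-trans z<s large)
  minimum = minimum-degree G v₀
  δ = degree G (proj₁ minimum)
  δ≤degree : ∀ v → δ ≤ degree G v
  δ≤degree = proj₂ minimum
  2n<5δ : 2 * n < 5 * δ
  2n<5δ = nine-twentieths⇒two-fifths {d = δ} (<-≤-trans z<s large)
    (nine-twentieths-degree k n δ α β k≥2 α≤1/4 β≤α/[2k+1] (degree≥ (proj₁ minimum)))
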